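{- There exists a $6$-eigenfunction $h$ of $H(3,3)$ such that $\mathrm{SND}(h)=2$.
   Context: $H(3,3)$ is the graph on $\mathbb{Z}_3^3$ in which two vertices are adjacent iff they differ in exactly one coordinate. For a graph $G$ with vertex set $V$ and real $\lambda$, a $\lambda$-eigenfunction of $G$ is a function $f:V\to\mathbb{R}$, $f\not\equiv 0$, with $\lambda f(x)=\sum_{y\in N(x)}(f(x)-f(y))$ for all $x\in V$, $N(x)$ being the neighbourhood of $x$. A positive (negative) strong nodal domain of $f$ is a maximal connected induced subgraph of $G$ on vertices $x$ with $f(x)>0$ ($f(x)<0$); $\mathrm{SND}(f)$ is the total number of strong nodal domains of $f$. -}

module Defs where

open import Data.Nat using (ℕ; zero; suc; _+_)
open import Data.Fin using (Fin) renaming (_≟_ to _≟ᶠ_)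
open import Data.Fin.Base using () renaming (zero to f0; suc to fs)
open import Data.Vec using (Vec; []; _∷_)
open import Data.List using (List; []; _∷_; map; concatMap; length; foldr)
open import Data.List.Relation.Unary.All using (All)
open import Data.List.Relation.Unary.Any using (Any)
open import Data.List.Relation.Unary.AllPairs using (AllPairs)
open import Data.Integer using (ℤ; _-_; _<_; _*_) renaming (_+_ to _+ℤ_; +_ to pos)
open import Data.Product using (Σ; ∃; _×_; _,_)
open import Relation.Nullary using (¬_; yes; no)
open import Relation.Binary.PropositionalEquality using (_≡_)
open import Data.Nat using () renaming (_≟_ to _≟ℕ_)

-- Z_3 is represented by Fin 3; vertices of H(3,3) are words of length 3.
V : Set
V = Vec (Fin 3) 3

ham : ∀ {n} → Vec (Fin 3) n → Vec (Fin 3) n → ℕ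
ham [] [] = 0
ham (a ∷ as) (b ∷ bs) with a ≟ᶠ b
... | yes _ = ham as bs
... | no  _ = suc (ham as bs)

Adj : V → V → Set
Adj x y = ham x y ≡ 1

fin3 : List (Fin 3)
fin3 = f0 ∷ fs f0 ∷ fs (fs f0) ∷ []

allWords : (n : ℕ) → List (Vec (Fin 3) n)
allWords zero = [] ∷ []
allWords (suc n) = concatMap (λ a → map (a ∷_) (allWords n)) fin3

allV : List V
allV = allWords 3

laplaceSum : (V → ℤ) → V → ℤ
laplaceSum f x = foldr (λ y acc → term y +ℤ acc) (pos 0) allV
  where
  term : V → ℤ
  term y with ham x y ≟ℕ 1
  ... | yes _ = f x - f y
  ... | no  _ = pos 0

IsEigenfunction : ℤ → (V → ℤ) → Set
IsEigenfunction λ' f = (∃ λ x → ¬ (f x ≡ pos 0)) × (∀ x → λ' * f x ≡ laplaceSum f x)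

data Path (S : V → Set) : V → V → Set where
  here : ∀ {x} → S x → Path S x x
  step : ∀ {x y z} → S x → Adj x y → Path S y z → Path S x z

-- the induced subgraph on S has exactly n connected components:
-- a list of n representatives in S, pairwise in different components,
-- such that every vertex of S is connected to one of them.
NumComponents : (V → Set) → ℕ → Set
NumComponents S n =
  Σ (List V) λ reps →
    (length reps ≡ n) ×
    All S reps ×
    AllPairs (λ u v → ¬ Path S u v) reps ×
    (∀ x → S x → Any (Path S x) reps)

Pos Neg : (V → ℤ) → V → Set
Pos f x = pos 0 < f x
Neg f x = f x < pos 0

SNDIs : (V → ℤ) → ℕ → Set
SNDIs f k = Σ ℕ λ p → Σ ℕ λ q →
  (p + q ≡ k) × NumComponents (Pos f) p × NumComponents (Neg f) q

-- Write u = (1, -1, 0) and v = (1, 1, -2), two mean-zero functions on Z₃, i.e.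
-- 3-eigenfunctions of K₃. Each product u(xᵢ) v(xⱼ) with i ≠ j is then a
-- 6-eigenfunction of H(3,3) = K₃ □ K₃ □ K₃, hence so is the cyclic sum
-- h(x) = u(x₁) v(x₂) + u(x₂) v(x₃) + u(x₃) v(x₁). Its positive and its
-- negative vertices each induce a connected subgraph, so SND(h) = 1 + 1.
{-# OPTIONS --safe #-}
module Submission where

open import Defs
open import Data.Empty using (⊥-elim)
open import Data.Fin using (Fin; zero; suc)
open import Data.Fin.Properties using () renaming (_≟_ to _≟ᶠ_)
open import Data.Integer using (ℤ; +_; -_; _*_; _<?_; _≟_) renaming (_+_ to _+ℤ_)
open import Data.List using (List; []; _∷_; map)
open import Data.List.Membership.Propositional using (_∈_)
open import Data.List.Membership.Propositional.Properties using (∈-map⁺; ∈-concatMap⁺)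
open import Data.List.Relation.Unary.All as All using (All)
open import Data.List.Relation.Unary.Any as Any using (Any; here; there)
open import Data.List.Relation.Unary.AllPairs using ([]; _∷_)
open import Data.Maybe using (Maybe; just; nothing; _<∣>_; from-just)
import Data.Maybe as Maybe
open import Data.Maybe.Effectful using (applicative)
open import Data.Nat using (ℕ) renaming (zero to 0ℕ; suc to 1+_; _≟_ to _≟ℕ_)
open import Data.Product using (Σ; _×_; _,_)
open import Data.Vec using (Vec; []; _∷_)
open import Data.Vec.Properties using (≡-dec)
open import Level using (0ℓ)
open import Relation.Binary.PropositionalEquality using (_≡_; refl)
open import Relation.Nullary using (Dec; yes; no; map′; from-yes)
open import Relation.Unary using (Decidable)

fin3-complete : (a : Fin 3) → a ∈ fin3
fin3-complete zero             = here refl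
fin3-complete (suc zero)       = there (here refl)
fin3-complete (suc (suc zero)) = there (there (here refl))

allWords-complete : ∀ {n} (w : Vec (Fin 3) n) → w ∈ allWords n
allWords-complete []      = here refl
allWords-complete (a ∷ w) =
  ∈-concatMap⁺ (λ b → map (b ∷_) (allWords _))
    (Any.map (λ { refl → ∈-map⁺ (a ∷_) (allWords-complete w) })
             (fin3-complete a))

all? : {P : V → Set} → Decidable P → Dec (∀ x → P x)
all? P? = map′ (λ ps x → All.lookup ps (allWords-complete x))
               (λ p → All.tabulate (λ {x} _ → p x))
               (All.all? P? allV)

sequence : {P : V → Set} → ((x : V) → Maybe (P x)) → Maybe (∀ x → P x)
sequence p = Maybe.map (λ ps x → All.lookup ps (allWords-complete x))
                       (All.sequenceA 0ℓ applicative (All.tabulate (λ {x} _ → p x)))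

module PathSearch {S : V → Set} (S? : Decidable S) (r : V) where

  mutual
    pathFrom : ℕ → (x : V) → S x → Maybe (Path S x r)
    pathFrom k x s with ≡-dec _≟ᶠ_ x r
    ... | yes refl = just (here s)
    pathFrom 0ℕ     x s | no _ = nothing
    pathFrom (1+ k) x s | no _ = pathVia k x s allV

    pathVia : ℕ → (x : V) → S x → List V → Maybe (Path S x r)
    pathVia k x s []       = nothing
    pathVia k x s (y ∷ ys) with ham x y ≟ℕ 1 | S? y
    ... | yes x~y | yes sy = Maybe.map (step s x~y) (pathFrom k y sy) <∣> pathVia k x s ys
    ... | _       | _      = pathVia k x s ys

  reachesRoot : ℕ → Maybe (∀ x → S x → Path S x r)
  reachesRoot k = sequence reaches
    where
    reaches : (x : V) → Maybe (S x → Path S x r)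
    reaches x with S? x
    ... | yes s = Maybe.map (λ p _ → p) (pathFrom k x s)
    ... | no ¬s = just (λ s → ⊥-elim (¬s s))

reachable⇒oneComponent : {S : V → Set} {r : V} →
                         S r → (∀ x → S x → Path S x r) → NumComponents S 1
reachable⇒oneComponent {r = r} sr reach =
  r ∷ [] , refl , sr All.∷ All.[] , All.[] ∷ [] , λ x sx → here (reach x sx)

u v : Fin 3 → ℤ
u zero             = + 1
u (suc zero)       = - + 1
u (suc (suc zero)) = + 0
v zero             = + 1
v (suc zero)       = + 1
v (suc (suc zero)) = - + 2

h : V → ℤ
h (a ∷ b ∷ c ∷ []) = u a * v b +ℤ u b * v c +ℤ u c * v a

maxVertex minVertex : V
maxVertex = zero ∷ zero ∷ zero ∷ []
minVertex = zero ∷ suc (suc zero) ∷ suc zero ∷ []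

h-eigen : ∀ x → + 6 * h x ≡ laplaceSum h x
h-eigen = from-yes (all? (λ x → + 6 * h x ≟ laplaceSum h x))

-- 3 is the eccentricity of each root within its sign domain.
pos-connected : ∀ x → Pos h x → Path (Pos h) x maxVertex
pos-connected = from-just (PathSearch.reachesRoot (λ x → + 0 <? h x) maxVertex 3)

neg-connected : ∀ x → Neg h x → Path (Neg h) x minVertex
neg-connected = from-just (PathSearch.reachesRoot (λ x → h x <? + 0) minVertex 3)

lemma14 : Σ (V → ℤ) λ h → IsEigenfunction (+ 6) h × SNDIs h 2
lemma14 =
  h , ((maxVertex , λ ()) , h-eigen) ,
  1 , 1 , refl ,
  reachable⇒oneComponent (from-yes (+ 0 <? h maxVertex)) pos-connected ,
  reachable⇒oneComponent (from-yes (h minVertex <? + 0)) neg-connected
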